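{- Let $\mathcal C\subseteq 2^{[n]}$ be an intersection-complete neural code and $i\in[n]$ a non-redundant, nontrivial neuron. Let $f:\mathcal C\to\mathcal C^{(i)}$ be the natural surjective morphism. Then $\mathcal C^{(i)}$ is intersection-complete, and $\mathcal I=f(\mathrm{Tk}_{\mathcal C}(i))$ is an isolated subset of $\mathcal C^{(i)}$.
   Context: A neural code is a set $\mathcal C\subseteq 2^{[n]}$ containing $\varnothing$. For $\sigma\subseteq[n]$, the trunk $\mathrm{Tk}_{\mathcal C}(\sigma)=\{\tau\in\mathcal C:\sigma\subseteq\tau\}$. A code is intersection-complete if closed under pairwise intersection. A neuron $i$ is trivial if $\mathrm{Tk}_{\mathcal C}(i):=\mathrm{Tk}_{\mathcal C}(\{i\})=\varnothing$, and redundant if $\mathrm{Tk}_{\mathcal C}(i)=\mathrm{Tk}_{\mathcal C}(\sigma)$ for some $\sigma\subseteq[n]\setminus\{i\}$. Given trunks $T_1,\dots,T_m$ in $\mathcal C$, the morphism determined by them is $c\mapsto\{j\in[m]:c\in T_j\}$. With $T_j=\mathrm{Tk}_{\mathcal C}(j)$, the $i$th covered code $\mathcal C^{(i)}$ is the image of $\mathcal C$ under the morphism determined by (an indexing of) the collection $\{T_j: T_j\neq T_i\}\cup\{T_j\cap T_i: T_j\cap T_i\neq T_i\}$, and the natural surjective morphism $f:\mathcal C\to\mathcal C^{(i)}$ is this map with codomain $\mathcal C^{(i)}$. If $\mathcal E$ is intersection-complete, a subset $\mathcal I\subseteq\mathcal E$ is isolated if it is nonempty and closed under pairwise intersection (so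 it has a least element $\mu$), and there are no $\sigma\in\mathcal E\setminus\mathcal I$ and $\tau\in\mathcal I\setminus\{\mu\}$ with $\tau\subseteq\sigma$. -}

module Defs where

open import Level using (Level; 0ℓ; suc)
open import Data.Bool using (Bool; true; false)
open import Data.Nat using (ℕ)
open import Data.Fin using (Fin)
open import Data.Fin.Subset using (Subset; _∈_; _∉_; _⊆_; _∩_; ⊥)
open import Data.Product using (Σ; ∃; _×_; _,_)
open import Data.Sum using (_⊎_)
open import Relation.Nullary using (¬_)
open import Relation.Unary using (Pred; _≐_)
open import Relation.Binary.PropositionalEquality using (_≡_; _≢_)

-- A neural code on [n]: a (finite, decidable) set of codewords, i.e. of
-- subsets of [n] = Fin n, given by its characteristic function.
Code : ℕ → Set
Code n = Subset n → Bool

⟦_⟧ : ∀ {n} → Code n → Pred (Subset n) 0ℓ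
⟦ C ⟧ c = C c ≡ true

IsNeuralCode : ∀ {n} → Code n → Set
IsNeuralCode C = ⟦ C ⟧ ⊥

IntersectionComplete : ∀ {n} → Pred (Subset n) 0ℓ → Set
IntersectionComplete {n} E = ∀ (c d : Subset n) → E c → E d → E (c ∩ d)

Tk : ∀ {n} → Code n → Subset n → Pred (Subset n) 0ℓ
Tk C σ τ = ⟦ C ⟧ τ × σ ⊆ τ

Tk₁ : ∀ {n} → Code n → Fin n → Pred (Subset n) 0ℓ
Tk₁ C i τ = ⟦ C ⟧ τ × i ∈ τ

Empty : ∀ {n} → Pred (Subset n) 0ℓ
Empty _ = Data.Empty.⊥
  where import Data.Empty

Trivial : ∀ {n} → Code n → Fin n → Set
Trivial C i = Tk₁ C i ≐ Empty

Redundant : ∀ {n} → Code n → Fin n → Set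
Redundant {n} C i = Σ (Subset n) λ σ → i ∉ σ × (Tk₁ C i ≐ Tk C σ)

_⊓_ : ∀ {n} → Pred (Subset n) 0ℓ → Pred (Subset n) 0ℓ → Pred (Subset n) 0ℓ
(P ⊓ Q) c = P c × Q c

-- Membership in the collection
--   { T_j : T_j ≠ T_i } ∪ { T_j ∩ T_i : T_j ∩ T_i ≠ T_i },  T_j = Tk_C(j).
InCoveringCollection : ∀ {n} → Code n → Fin n → Pred (Subset n) 0ℓ → Set
InCoveringCollection {n} C i P =
    (Σ (Fin n) λ j → ¬ (Tk₁ C j ≐ Tk₁ C i) × (P ≐ Tk₁ C j))
  ⊎ (Σ (Fin n) λ j → ¬ ((Tk₁ C j ⊓ Tk₁ C i) ≐ Tk₁ C i) × (P ≐ (Tk₁ C j ⊓ Tk₁ C i)))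

IsCoveringIndexing : ∀ {n} → Code n → Fin n → (m : ℕ) → (Fin m → Pred (Subset n) 0ℓ) → Set₁
IsCoveringIndexing {n} C i m T =
    (∀ k → InCoveringCollection C i (T k))
  × (∀ (P : Pred (Subset n) 0ℓ) → InCoveringCollection C i P → Σ (Fin m) λ k → T k ≐ P)
  × (∀ k k′ → T k ≐ T k′ → k ≡ k′)

-- Graph of the morphism determined by trunks T_1,…,T_m:
--   c ↦ { k ∈ [m] : c ∈ T_k }.   MapsTo T c d  means  f(c) = d.
MapsTo : ∀ {n m} → (Fin m → Pred (Subset n) 0ℓ) → Subset n → Subset m → Set
MapsTo {n} {m} T c d = ∀ (k : Fin m) → (k ∈ d → T k c) × (T k c → k ∈ d)

Image : ∀ {n m} → (Fin m → Pred (Subset n) 0ℓ) → Pred (Subset n) 0ℓ → Pred (Subset m) 0ℓ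
Image {n} T S d = Σ (Subset n) λ c → S c × MapsTo T c d

Isolated : ∀ {m} → Pred (Subset m) 0ℓ → Pred (Subset m) 0ℓ → Set
Isolated {m} E I =
    (∀ c → I c → E c)
  × (Σ (Subset m) I)
  × IntersectionComplete I
  × Σ (Subset m) λ μ →
        I μ
      × (∀ τ → I τ → μ ⊆ τ)
      × (¬ (Σ (Subset m) λ σ → Σ (Subset m) λ τ →
              E σ × ¬ I σ × I τ × τ ≢ μ × τ ⊆ σ))

-- Each trunk T_k of the covering collection is either Tk(j) or Tk(j) ∩ Tk(i), so inside
-- the intersection-complete code C it is closed under intersection and upward closed.
-- Hence f(c) = {k : c ∈ T_k} satisfies f(c ∩ c′) = f(c) ∩ f(c′) and is monotone on C:
-- the image is intersection-complete, and the least codeword μ of Tk(i) (which exists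
-- because Tk(i) is finite, nonempty and closed under intersection) maps to the least
-- element of f(Tk(i)). If f(c) ≠ f(μ) for some c ∈ Tk(i), some T_k, hence some Tk(j),
-- contains c but not μ. Then Tk(j) ∩ Tk(i) ≠ Tk(i) is itself one of the trunks; it
-- contains c, so every codeword d with f(c) ⊆ f(d) lies in it, and thus in Tk(i).
module Submission where

open import Defs
open import Data.Nat using (ℕ)
open import Data.Bool using (true) renaming (_≟_ to _≟ᵇ_)
open import Data.Fin using (Fin)
open import Data.Fin.Subset using (Subset; _∈_; _⊆_; _⊂_; _⊄_; _∩_)
open import Data.Fin.Subset.Properties
  using (_∈?_; _⊂?_; ⊆-antisym; p∩q⊆p; p∩q⊆q; x∈p∩q⁺; x∈p∩q⁻; anySubset?)
open import Data.Fin.Subset.Induction using (⊂-wellFounded)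
open import Data.Empty using (⊥-elim)
open import Data.Product using (∃; _×_; _,_; proj₁; proj₂)
open import Data.Sum using (inj₁; inj₂)
open import Data.Vec using (tabulate)
open import Data.Vec.Properties using (lookup∘tabulate; lookup⇒[]=; []=⇒lookup)
open import Function using (_∘_)
open import Induction.WellFounded using (Acc; acc)
open import Level using (0ℓ)
open import Relation.Binary.PropositionalEquality using (_≡_; _≢_; sym; trans)
open import Relation.Nullary using (¬_; Dec; yes; no; does; contradiction)
open import Relation.Nullary.Decidable using (_×-dec_; map′; dec-true)
open import Relation.Unary using (Pred; Decidable; _≐_)
open import Relation.Unary.Properties using (≐-refl)

private
  variable
    n m : ℕ
    p q : Subset n

does≡true⇒ : ∀ {A : Set} (a? : Dec A) → does a? ≡ true → A
does≡true⇒ (yes a) _ = a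
does≡true⇒ (no _) ()

module _ {P : Pred (Fin m) 0ℓ} (P? : Decidable P) (k : Fin m) where

  ∈-tabulate-does⁺ : P k → k ∈ tabulate (does ∘ P?)
  ∈-tabulate-does⁺ Pk =
    lookup⇒[]= k _ (trans (lookup∘tabulate (does ∘ P?) k) (dec-true (P? k) Pk))

  ∈-tabulate-does⁻ : k ∈ tabulate (does ∘ P?) → P k
  ∈-tabulate-does⁻ k∈ =
    does≡true⇒ (P? k) (trans (sym (lookup∘tabulate (does ∘ P?) k)) ([]=⇒lookup k∈))

⊆∧≢⇒⊂ : p ⊆ q → p ≢ q → p ⊂ q
⊆∧≢⇒⊂ {p = p} {q} p⊆q p≢q with p ⊂? q
... | yes p⊂q = p⊂q
... | no p⊄q = contradiction (⊆-antisym p⊆q q⊆p) p≢q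
  where
  q⊆p : q ⊆ p
  q⊆p {x} x∈q with x ∈? p
  ... | yes x∈p = x∈p
  ... | no x∉p = ⊥-elim (p⊄q (p⊆q , x , x∈q , x∉p))

module _ {P : Pred (Subset n) 0ℓ} where

  ¬≐Empty⇒∃ : Decidable P → ¬ (P ≐ Empty) → ∃ P
  ¬≐Empty⇒∃ P? P≉∅ with anySubset? P?
  ... | yes ∃P = ∃P
  ... | no ∄P = contradiction ((λ {c} Pc → ∄P (c , Pc)) , λ ()) P≉∅

  ∃-minimal : Decidable P → ∀ {c} → Acc _⊂_ c → P c →
              ∃ λ μ → P μ × (∀ {d} → P d → d ⊄ μ)
  ∃-minimal P? {c} (acc rs) Pc with anySubset? (λ d → P? d ×-dec d ⊂? c)
  ... | yes (d , Pd , d⊂c) = ∃-minimal P? (rs d⊂c) Pd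
  ... | no ∄d⊂c = c , Pc , λ Pd d⊂c → ∄d⊂c (_ , Pd , d⊂c)

  minimal⇒least : IntersectionComplete P → ∀ {μ} → P μ → (∀ {d} → P d → d ⊄ μ) →
                  ∀ d → P d → μ ⊆ d
  minimal⇒least ∩-closed {μ} Pμ minimal d Pd {x} x∈μ with x ∈? d
  ... | yes x∈d = x∈d
  ... | no x∉d =
    ⊥-elim (minimal (∩-closed μ d Pμ Pd) (p∩q⊆p μ d , x , x∈μ , x∉d ∘ proj₂ ∘ x∈p∩q⁻ μ d))

  ∃-least : Decidable P → IntersectionComplete P → ∃ P →
            ∃ λ μ → P μ × (∀ d → P d → μ ⊆ d)
  ∃-least P? ∩-closed (c , Pc) with ∃-minimal P? (⊂-wellFounded c) Pc
  ... | μ , Pμ , minimal = μ , Pμ , minimal⇒least ∩-closed Pμ minimal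

record IsDecFilter (C : Code n) (P : Pred (Subset n) 0ℓ) : Set where
  field
    decide   : Decidable P
    ∩-closed : IntersectionComplete P
    ↑-closed : ∀ {c d} → P c → ⟦ C ⟧ d → c ⊆ d → P d

module _ {C : Code n} where

  Tk₁-isDecFilter : IntersectionComplete ⟦ C ⟧ → ∀ j → IsDecFilter C (Tk₁ C j)
  Tk₁-isDecFilter ic j = record
    { decide   = λ c → (C c ≟ᵇ true) ×-dec (j ∈? c)
    ; ∩-closed = λ c d (Cc , j∈c) (Cd , j∈d) → ic c d Cc Cd , x∈p∩q⁺ (j∈c , j∈d)
    ; ↑-closed = λ (_ , j∈c) Cd c⊆d → Cd , c⊆d j∈c
    }

  ⊓-isDecFilter : ∀ {P Q} → IsDecFilter C P → IsDecFilter C Q → IsDecFilter C (P ⊓ Q)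
  ⊓-isDecFilter P-filter Q-filter = record
    { decide   = λ c → P.decide c ×-dec Q.decide c
    ; ∩-closed = λ c d (Pc , Qc) (Pd , Qd) → P.∩-closed c d Pc Pd , Q.∩-closed c d Qc Qd
    ; ↑-closed = λ (Pc , Qc) Cd c⊆d → P.↑-closed Pc Cd c⊆d , Q.↑-closed Qc Cd c⊆d
    }
    where
    module P = IsDecFilter P-filter
    module Q = IsDecFilter Q-filter

  isDecFilter-≐ : ∀ {P Q} → P ≐ Q → IsDecFilter C Q → IsDecFilter C P
  isDecFilter-≐ (P⊆Q , Q⊆P) Q-filter = record
    { decide   = map′ Q⊆P P⊆Q ∘ decide
    ; ∩-closed = λ c d Pc Pd → Q⊆P (∩-closed c d (P⊆Q Pc) (P⊆Q Pd))
    ; ↑-closed = λ Pc Cd c⊆d → Q⊆P (↑-closed (P⊆Q Pc) Cd c⊆d)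
    }
    where open IsDecFilter Q-filter

  covering-isDecFilter : IntersectionComplete ⟦ C ⟧ → ∀ {i P} →
                         InCoveringCollection C i P → IsDecFilter C P
  covering-isDecFilter ic (inj₁ (j , _ , P≐Tkⱼ)) =
    isDecFilter-≐ P≐Tkⱼ (Tk₁-isDecFilter ic j)
  covering-isDecFilter ic {i} (inj₂ (j , _ , P≐Tkⱼ∩Tkᵢ)) =
    isDecFilter-≐ P≐Tkⱼ∩Tkᵢ (⊓-isDecFilter (Tk₁-isDecFilter ic j) (Tk₁-isDecFilter ic i))

module Morphism {C : Code n} {T : Fin m → Pred (Subset n) 0ℓ}
                (T-isDecFilter : ∀ k → IsDecFilter C (T k)) where

  private
    module F k = IsDecFilter (T-isDecFilter k)

  image : Subset n → Subset m
  image c = tabulate (does ∘ λ k → F.decide k c)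

  image-mapsTo : ∀ c → MapsTo T c (image c)
  image-mapsTo c k = ∈-tabulate-does⁻ P? k , ∈-tabulate-does⁺ P? k
    where P? = λ k → F.decide k c

  mapsTo-∩ : ∀ {c c′ d d′} → ⟦ C ⟧ c → ⟦ C ⟧ c′ → MapsTo T c d → MapsTo T c′ d′ →
             MapsTo T (c ∩ c′) (d ∩ d′)
  mapsTo-∩ {c} {c′} {d} {d′} Cc Cc′ c↦d c′↦d′ k = from-∩ , to-∩
    where
    from-∩ : k ∈ d ∩ d′ → T k (c ∩ c′)
    from-∩ k∈d∩d′ with x∈p∩q⁻ d d′ k∈d∩d′
    ... | k∈d , k∈d′ = F.∩-closed k c c′ (proj₁ (c↦d k) k∈d) (proj₁ (c′↦d′ k) k∈d′)
    to-∩ : T k (c ∩ c′) → k ∈ d ∩ d′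
    to-∩ c∩c′∈T = x∈p∩q⁺ ( proj₂ (c↦d k) (F.↑-closed k c∩c′∈T Cc (p∩q⊆p c c′))
                         , proj₂ (c′↦d′ k) (F.↑-closed k c∩c′∈T Cc′ (p∩q⊆q c c′)))

  mapsTo-mono : ∀ {c c′ d d′} → ⟦ C ⟧ c′ → c ⊆ c′ → MapsTo T c d → MapsTo T c′ d′ →
                d ⊆ d′
  mapsTo-mono Cc′ c⊆c′ c↦d c′↦d′ {k} k∈d =
    proj₂ (c′↦d′ k) (F.↑-closed k (proj₁ (c↦d k) k∈d) Cc′ c⊆c′)

  module _ {S : Pred (Subset n) 0ℓ} (S⊆C : ∀ {c} → S c → ⟦ C ⟧ c) where

    Image-∩-closed : IntersectionComplete S → IntersectionComplete (Image T S)
    Image-∩-closed S-∩ _ _ (c , Sc , c↦d) (c′ , Sc′ , c′↦d′) =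
      c ∩ c′ , S-∩ c c′ Sc Sc′ , mapsTo-∩ (S⊆C Sc) (S⊆C Sc′) c↦d c′↦d′

    image-least : ∀ {μ} → (∀ c → S c → μ ⊆ c) → ∀ τ → Image T S τ → image μ ⊆ τ
    image-least {μ} μ-least _ (c , Sc , c↦τ) =
      mapsTo-mono (S⊆C Sc) (μ-least c Sc) (image-mapsTo μ) c↦τ

module Covering {C : Code n} {i : Fin n} (ic : IntersectionComplete ⟦ C ⟧)
                {T : Fin m → Pred (Subset n) 0ℓ} (cov : IsCoveringIndexing C i m T) where

  open Morphism (λ k → covering-isDecFilter ic (proj₁ cov k)) public

  private
    module Tkᵢ = IsDecFilter (Tk₁-isDecFilter ic i)

  separating-neuron : ∀ {μ c k} → Tk₁ C i μ → T k c → ¬ T k μ →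
                      ∃ λ j → Tk₁ C j c × ¬ Tk₁ C j μ
  separating-neuron {k = k} μ∈Tkᵢ c∈T μ∉T with proj₁ cov k
  ... | inj₁ (j , _ , T⊆Tkⱼ , Tkⱼ⊆T) = j , T⊆Tkⱼ c∈T , μ∉T ∘ Tkⱼ⊆T
  ... | inj₂ (j , _ , T⊆Tkⱼ∩Tkᵢ , Tkⱼ∩Tkᵢ⊆T) =
    j , proj₁ (T⊆Tkⱼ∩Tkᵢ c∈T) , λ μ∈Tkⱼ → μ∉T (Tkⱼ∩Tkᵢ⊆T (μ∈Tkⱼ , μ∈Tkᵢ))

  separating-trunk⇒trunk⊆Tkᵢ : ∀ {μ c k} → Tk₁ C i μ → Tk₁ C i c → T k c → ¬ T k μ →
                               ∃ λ k′ → T k′ c × (∀ {d} → T k′ d → Tk₁ C i d)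
  separating-trunk⇒trunk⊆Tkᵢ μ∈Tkᵢ c∈Tkᵢ c∈T μ∉T
    with separating-neuron μ∈Tkᵢ c∈T μ∉T
  ... | j , c∈Tkⱼ , μ∉Tkⱼ
    with proj₁ (proj₂ cov) (Tk₁ C j ⊓ Tk₁ C i)
           (inj₂ (j , (λ (_ , Tkᵢ⊆) → μ∉Tkⱼ (proj₁ (Tkᵢ⊆ μ∈Tkᵢ))) , ≐-refl))
  ... | k′ , T′⊆ , ⊆T′ = k′ , ⊆T′ (c∈Tkⱼ , c∈Tkᵢ) , proj₂ ∘ T′⊆

  Image-Tkᵢ-↑-closed : ∀ {μ σ τ} → Tk₁ C i μ → (∀ c → Tk₁ C i c → μ ⊆ c) →
                       Image T ⟦ C ⟧ σ → Image T (Tk₁ C i) τ → τ ≢ image μ → τ ⊆ σ →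
                       Image T (Tk₁ C i) σ
  Image-Tkᵢ-↑-closed {μ} {τ = τ} μ∈Tkᵢ μ-least (d , Cd , d↦σ) τ∈I@(c , c∈Tkᵢ , c↦τ) τ≢μ τ⊆σ
    with ⊆∧≢⇒⊂ (image-least proj₁ μ-least τ τ∈I) (τ≢μ ∘ sym)
  ... | _ , k , k∈τ , k∉μ
    with separating-trunk⇒trunk⊆Tkᵢ μ∈Tkᵢ c∈Tkᵢ (proj₁ (c↦τ k) k∈τ)
           (k∉μ ∘ proj₂ (image-mapsTo μ k))
  ... | k′ , c∈T′ , T′⊆Tkᵢ = d , T′⊆Tkᵢ (proj₁ (d↦σ k′) (τ⊆σ (proj₂ (c↦τ k′) c∈T′))) , d↦σ

  Tkᵢ-least : ¬ Trivial C i → ∃ λ μ → Tk₁ C i μ × (∀ c → Tk₁ C i c → μ ⊆ c)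
  Tkᵢ-least nontrivial = ∃-least Tkᵢ.decide Tkᵢ.∩-closed (¬≐Empty⇒∃ Tkᵢ.decide nontrivial)

  Image-Tkᵢ-isolated : ¬ Trivial C i → Isolated (Image T ⟦ C ⟧) (Image T (Tk₁ C i))
  Image-Tkᵢ-isolated nontrivial with Tkᵢ-least nontrivial
  ... | μ , μ∈Tkᵢ , μ-least =
      (λ _ (c , (Cc , _) , c↦d) → c , Cc , c↦d)
    , μ∈I
    , Image-∩-closed proj₁ Tkᵢ.∩-closed
    , image μ , proj₂ μ∈I , image-least proj₁ μ-least
    , λ (_ , _ , σ∈E , σ∉I , τ∈I , τ≢μ , τ⊆σ) →
        σ∉I (Image-Tkᵢ-↑-closed μ∈Tkᵢ μ-least σ∈E τ∈I τ≢μ τ⊆σ)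
    where
    μ∈I : ∃ (Image T (Tk₁ C i))
    μ∈I = image μ , μ , μ∈Tkᵢ , image-mapsTo μ

lemma39 : ∀ {n : ℕ} (C : Code n) (i : Fin n)
    → IsNeuralCode C
    → IntersectionComplete ⟦ C ⟧
    → ¬ Redundant C i
    → ¬ Trivial C i
    → (m : ℕ) (T : Fin m → Pred (Subset n) 0ℓ)
    → IsCoveringIndexing C i m T
    → IntersectionComplete (Image T ⟦ C ⟧)
    × Isolated (Image T ⟦ C ⟧) (Image T (Tk₁ C i))
lemma39 C i _ ic _ nontrivial m T cov =
  Image-∩-closed (λ Cc → Cc) ic , Image-Tkᵢ-isolated nontrivial
  where open Covering ic cov
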